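{- For every positive integer $i$, every level component in $L_i$ is either a clique or a $2$-clique.
   Context: Let $G$ be a graph with no induced claw ($K_{1,3}$) and no even hole (induced cycle of even length at least $4$). Fix two adjacent vertices $u_0,u_1$ of $G$, let $B_0=N_G(u_0)\setminus\{u_1\}$, and let $G_0$ be the connected component of $G-B_0$ containing $u_0$. For $j\ge 0$, $L_j=\{u\in V(G_0): d_{G_0}(u,u_0)=j\}$. A level component in $L_i$ is a connected component of the induced subgraph $G_0[L_i]$. A $2$-clique is a connected graph whose vertex set is partitioned into three nonempty sets $A,B,K$ such that $A\cup K$ and $B\cup K$ are cliques and no vertex of $A$ is adjacent to a vertex of $B$; it is denoted $C(A,B,K)$. -}

module Defs where

open import Level using (0ℓ)
open import Data.Nat using (ℕ; zero; suc; _<_; _≤_; _*_)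
open import Data.Fin using (Fin; toℕ)
open import Data.Product using (Σ; ∃; _×_; _,_)
open import Data.Sum using (_⊎_)
open import Data.Empty using (⊥)
open import Relation.Nullary using (¬_; Dec)
open import Relation.Unary using (Pred)
open import Relation.Binary.PropositionalEquality using (_≡_; _≢_)
open import Function.Definitions using (Injective)
open import Function.Bundles using (_⇔_)

record Graph (n : ℕ) : Set₁ where
  field
    E     : Fin n → Fin n → Set
    E-sym : ∀ {x y} → E x y → E y x
    E-irr : ∀ {x} → ¬ E x x
    E-dec : ∀ x y → Dec (E x y)

module _ {n : ℕ} (G : Graph n) where
  open Graph G

  HasInducedClaw : Set
  HasInducedClaw = Σ (Fin n) λ c → Σ (Fin n) λ a → Σ (Fin n) λ b → Σ (Fin n) λ d →
    (a ≢ b) × (a ≢ d) × (b ≢ d) ×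
    E c a × E c b × E c d ×
    ¬ E a b × ¬ E a d × ¬ E b d

  Consec : (k : ℕ) → Fin k → Fin k → Set
  Consec k i j = (toℕ j ≡ suc (toℕ i)) ⊎ (toℕ i ≡ suc (toℕ j))
               ⊎ ((toℕ i ≡ 0) × (suc (toℕ j) ≡ k))
               ⊎ ((toℕ j ≡ 0) × (suc (toℕ i) ≡ k))

  InducedCycle : (k : ℕ) → (Fin k → Fin n) → Set
  InducedCycle k f = Injective _≡_ _≡_ f × (∀ i j → E (f i) (f j) ⇔ Consec k i j)

  HasEvenHole : Set
  HasEvenHole = Σ ℕ λ k → (4 ≤ k) × (Σ ℕ λ m → k ≡ 2 * m) ×
                Σ (Fin k → Fin n) λ f → InducedCycle k f

  -- Walks of length k all of whose vertices lie in S
  -- (i.e. walks in the induced subgraph G[S]).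
  data Walk (S : Pred (Fin n) 0ℓ) : Fin n → Fin n → ℕ → Set where
    here : ∀ {x} → S x → Walk S x x 0
    step : ∀ {x y z k} → S x → E x y → Walk S y z k → Walk S x z (suc k)

  DistIn : Pred (Fin n) 0ℓ → Fin n → Fin n → ℕ → Set
  DistIn S x y j = Walk S x y j × (∀ m → m < j → ¬ Walk S x y m)

  IsClique : Pred (Fin n) 0ℓ → Set
  IsClique S = ∀ x y → S x → S y → x ≢ y → E x y

  -- S induces a 2-clique C(A,B,K): S is partitioned into nonempty A, B, K
  -- with A ∪ K and B ∪ K cliques and no edges between A and B.
  -- (Connectedness is implied by K nonempty and the clique conditions.)
  Is2Clique : Pred (Fin n) 0ℓ → Set₁
  Is2Clique S = Σ (Pred (Fin n) 0ℓ) λ A → Σ (Pred (Fin n) 0ℓ) λ B → Σ (Pred (Fin n) 0ℓ) λ K →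
    (∀ v → S v → A v ⊎ B v ⊎ K v) ×
    (∀ v → A v → S v) × (∀ v → B v → S v) × (∀ v → K v → S v) ×
    (∀ v → A v → B v → ⊥) × (∀ v → A v → K v → ⊥) × (∀ v → B v → K v → ⊥) ×
    (∃ A) × (∃ B) × (∃ K) ×
    IsClique (λ v → A v ⊎ K v) × IsClique (λ v → B v ⊎ K v) ×
    (∀ a b → A a → B b → ¬ E a b)

  module Levels (u₀ u₁ : Fin n) where
    B₀ : Pred (Fin n) 0ℓ
    B₀ v = E u₀ v × v ≢ u₁

    NotB₀ : Pred (Fin n) 0ℓ
    NotB₀ v = ¬ B₀ v

    G₀ : Pred (Fin n) 0ℓ
    G₀ v = ∃ λ k → Walk NotB₀ u₀ v k

    L : ℕ → Pred (Fin n) 0ℓ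
    L j v = G₀ v × DistIn G₀ u₀ v j

    LevelComp : ℕ → Fin n → Pred (Fin n) 0ℓ
    LevelComp i x y = ∃ λ k → Walk (L i) x y k

-- Work in the breadth-first layering of G₀ from u₀, where L₁ = {u₁}.  Claw-freeness
-- forbids two nonadjacent vertices of a level Lᵢ (i ≥ 2) from having a common
-- neighbour in Lᵢ₋₁.  Even-hole-freeness forbids two adjacent vertices x, y of Lᵢ with
-- neighbours x′, y′ in Lᵢ₋₁ such that x′y and y′x are non-edges: following parents
-- downwards, the two paths x′x and y′y grow into a ladder that can only close into an
-- even hole, because it cannot reach the single vertex of L₁ with two distinct feet.
-- Chasing these two facts along an induced P₄ of Lᵢ shows that Lᵢ has no induced P₄,
-- so a level component has diameter at most two and no stable set of size three.
-- Hence it is a clique, or, for a nonadjacent pair a, b, splits into the vertices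
-- missing b, those missing a, and the common neighbours of a and b: a 2-clique.
module Submission where

open import Defs
open import Level using (0ℓ)
open import Data.Nat
  using (ℕ; zero; suc; _+_; _*_; _∸_; _≤_; _<_; z≤n; s≤s; z<s; s≤s⁻¹; _≤?_; _≟_; anyUpTo?; allUpTo?)
open import Data.Nat.Properties
open import Data.Fin using (Fin; toℕ) renaming (_≟_ to _≟ᶠ_)
open import Data.Fin.Properties using (any?; toℕ-injective; toℕ<n)
open import Data.Product using (∃; _×_; _,_; proj₁; proj₂)
open import Data.Sum as Sum using (_⊎_; inj₁; inj₂; [_,_])
open import Data.Empty using (⊥; ⊥-elim)
open import Function using (const)
open import Function.Bundles using (mk⇔)
open import Relation.Nullary using (¬_; Dec; yes; no)
open import Relation.Nullary.Decidable using (_×-dec_; ¬?; map′)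
open import Relation.Unary using (Pred; Decidable; _⊆_)
open import Relation.Binary.Definitions using (tri<; tri≈; tri>)
open import Relation.Binary.PropositionalEquality using (_≡_; _≢_; refl; sym; trans; cong; subst; subst₂)

_◂_ : {A : Set} → A → (ℕ → A) → ℕ → A
(a ◂ Z) zero    = a
(a ◂ Z) (suc t) = Z t

differByOne : ∀ {s t} → t ≤ suc s → s ≤ suc t → s ≢ t → t ≡ suc s ⊎ s ≡ suc t
differByOne {s} {t} t≤1+s s≤1+t s≢t with <-cmp s t
... | tri< s<t _ _ = inj₁ (≤-antisym t≤1+s s<t)
... | tri≈ _ s≡t _ = ⊥-elim (s≢t s≡t)
... | tri> _ _ t<s = inj₂ (≤-antisym s≤1+t t<s)

module GraphBasics {n : ℕ} (G : Graph n) where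
  open Graph G

  edge⇒≢ : ∀ {x y} → E x y → x ≢ y
  edge⇒≢ e refl = E-irr e

  walk-source : ∀ {S x y k} → Walk G S x y k → S x
  walk-source (here s)     = s
  walk-source (step s _ _) = s

  walk-target : ∀ {S x y k} → Walk G S x y k → S y
  walk-target (here s)     = s
  walk-target (step _ _ w) = walk-target w

  walk-snoc : ∀ {S x y z k} → Walk G S x y k → E y z → S z → Walk G S x z (suc k)
  walk-snoc (here s)     e  sz = step s e (here sz)
  walk-snoc (step s e w) e′ sz = step s e (walk-snoc w e′ sz)

  walk-unsnoc : ∀ {S x z k} → Walk G S x z (suc k) → ∃ λ y → Walk G S x y k × E y z
  walk-unsnoc (step s e (here _))         = _ , here s , e
  walk-unsnoc (step s e w@(step _ _ _)) with walk-unsnoc w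
  ... | y , w′ , e′ = y , step s e w′ , e′

  walk-reverse : ∀ {S x y k} → Walk G S x y k → Walk G S y x k
  walk-reverse (here s)     = here s
  walk-reverse (step s e w) = walk-snoc (walk-reverse w) (E-sym e) s

  walk-++ : ∀ {S x y z k l} → Walk G S x y k → Walk G S y z l → Walk G S x z (k + l)
  walk-++ (here _)     w′ = w′
  walk-++ (step s e w) w′ = step s e (walk-++ w w′)

  walk-map : ∀ {S T : Pred (Fin n) 0ℓ} {x y k} → S ⊆ T → Walk G S x y k → Walk G T x y k
  walk-map S⊆T (here s)     = here (S⊆T s)
  walk-map S⊆T (step s e w) = step (S⊆T s) e (walk-map S⊆T w)

  walk-withinComponent : ∀ {S a y z j k} → Walk G S a y j → Walk G S y z k →
                         Walk G (λ v → ∃ λ l → Walk G S a v l) y z k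
  walk-withinComponent p (here _)     = here (_ , p)
  walk-withinComponent p (step s e w) =
    step (_ , p) e (walk-withinComponent (walk-snoc p e (walk-source w)) w)

  walk? : ∀ {S} → Decidable S → ∀ k x y → Dec (Walk G S x y k)
  walk? S? zero x y with S? x ×-dec (x ≟ᶠ y)
  ... | yes (s , refl) = yes (here s)
  ... | no ¬here       = no λ { (here s) → ¬here (s , refl) }
  walk? S? (suc k) x y with S? x ×-dec any? (λ z → E-dec x z ×-dec walk? S? k z y)
  ... | yes (s , _ , e , w) = yes (step s e w)
  ... | no ¬step            = no λ { (step s e w) → ¬step (s , _ , e , w) }

  Dist≤2 : Pred (Fin n) 0ℓ → Fin n → Fin n → Set
  Dist≤2 S a b = a ≡ b ⊎ E a b ⊎ ∃ λ m → S m × E a m × E m b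

  dist≤2⇒walk : ∀ {S a b} → S a → S b → Dist≤2 S a b → ∃ λ k → k < 3 × Walk G S a b k
  dist≤2⇒walk sa _  (inj₁ refl)                    = 0 , z<s , here sa
  dist≤2⇒walk sa sb (inj₂ (inj₁ e))                = 1 , s≤s z<s , step sa e (here sb)
  dist≤2⇒walk sa sb (inj₂ (inj₂ (_ , sm , e , e′))) = 2 , s≤s (s≤s z<s) , step sa e (step sm e′ (here sb))

  NonadjacentPair : Pred (Fin n) 0ℓ → Set
  NonadjacentPair S = ∃ λ a → ∃ λ b → S a × S b × a ≢ b × ¬ E a b

  clique⊎nonadjacentPair : ∀ {S} → Decidable S → IsClique G S ⊎ NonadjacentPair S
  clique⊎nonadjacentPair {S} S?
    with any? (λ a → any? (λ b → S? a ×-dec S? b ×-dec ¬? (a ≟ᶠ b) ×-dec ¬? (E-dec a b)))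
  ... | yes pair = inj₂ pair
  ... | no ¬pair = inj₁ clique
    where
    clique : IsClique G S
    clique v w sv sw v≢w with E-dec v w
    ... | yes e = e
    ... | no ¬e = ⊥-elim (¬pair (v , w , sv , sw , v≢w , ¬e))

module InducedCycles {n : ℕ} (G : Graph n) where
  open Graph G
  open GraphBasics G

  record ParallelInducedPaths (h : ℕ) (X Y : ℕ → Fin n) : Set where
    field
      X-step      : ∀ t → t < h → E (X t) (X (suc t))
      Y-step      : ∀ t → t < h → E (Y t) (Y (suc t))
      X-chordless : ∀ {s t} → s ≤ h → t ≤ h → E (X s) (X t) → t ≡ suc s ⊎ s ≡ suc t
      Y-chordless : ∀ {s t} → s ≤ h → t ≤ h → E (Y s) (Y t) → t ≡ suc s ⊎ s ≡ suc t
      X-injective : ∀ {s t} → s ≤ h → t ≤ h → X s ≡ X t → s ≡ t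
      Y-injective : ∀ {s t} → s ≤ h → t ≤ h → Y s ≡ Y t → s ≡ t
      XY-disjoint : ∀ {s t} → s ≤ h → t ≤ h → X s ≢ Y t
      XY-edges    : ∀ {s t} → s ≤ h → t ≤ h → E (X s) (Y t) → (s ≡ 0 × t ≡ 0) ⊎ (s ≡ h × t ≡ h)
      bottom-rung : E (X 0) (Y 0)
      top-rung    : E (X h) (Y h)

  module ParallelPathsCycle {h X Y} (P : ParallelInducedPaths h X Y) where
    open ParallelInducedPaths P

    last : ℕ
    last = suc (h + h)

    length : ℕ
    length = 2 * suc h

    length≡1+last : length ≡ suc last
    length≡1+last = cong suc (trans (cong (h +_) (+-identityʳ (suc h))) (+-suc h h))

    -- Positions 0 … h run up X and positions h+1 … last run down Y.
    cycle : ℕ → Fin n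
    cycle p with p ≤? h
    ... | yes _ = X p
    ... | no  _ = Y (last ∸ p)

    cycle-X : ∀ {s} → s ≤ h → cycle s ≡ X s
    cycle-X {s} s≤h with s ≤? h
    ... | yes _   = refl
    ... | no  s≰h = ⊥-elim (s≰h s≤h)

    cycle-Y : ∀ {p t} → t ≤ h → p + t ≡ last → cycle p ≡ Y t
    cycle-Y {p} {t} t≤h p+t≡last with p ≤? h
    ... | yes p≤h = ⊥-elim (1+n≰n (subst (_≤ h + h) p+t≡last (+-mono-≤ p≤h t≤h)))
    ... | no  _   = cong Y (trans (cong (_∸ p) (sym p+t≡last)) (m+n∸m≡n p t))

    data Position : ℕ → Set where
      onX : ∀ {s}   → s ≤ h → Position s
      onY : ∀ {p t} → t ≤ h → p + t ≡ last → Position p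

    position : ∀ p → p < length → Position p
    position p p<length with p ≤? h
    ... | yes p≤h = onX p≤h
    ... | no  p≰h = onY (subst (last ∸ p ≤_) (m+n∸m≡n h h) (∸-monoʳ-≤ last (≰⇒> p≰h)))
                        (m+[n∸m]≡n (s≤s⁻¹ (subst (suc p ≤_) length≡1+last p<length)))

    Consecutive : ℕ → ℕ → Set
    Consecutive p q = (q ≡ suc p) ⊎ (p ≡ suc q) ⊎ ((p ≡ 0) × (suc q ≡ length)) ⊎ ((q ≡ 0) × (suc p ≡ length))

    consecutive-sym : ∀ {p q} → Consecutive p q → Consecutive q p
    consecutive-sym (inj₁ c)               = inj₂ (inj₁ c)
    consecutive-sym (inj₂ (inj₁ c))        = inj₁ c
    consecutive-sym (inj₂ (inj₂ (inj₁ c))) = inj₂ (inj₂ (inj₂ c))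
    consecutive-sym (inj₂ (inj₂ (inj₂ c))) = inj₂ (inj₂ (inj₁ c))

    rung⇒consecutive : ∀ {s q t} → s ≤ h → t ≤ h → q + t ≡ last → E (X s) (Y t) → Consecutive s q
    rung⇒consecutive {q = q} s≤h t≤h q+t≡last e with XY-edges s≤h t≤h e
    ... | inj₁ (refl , refl) =
      inj₂ (inj₂ (inj₁ (refl , trans (cong suc (trans (sym (+-identityʳ q)) q+t≡last)) (sym length≡1+last))))
    ... | inj₂ (refl , refl) = inj₁ (+-cancelʳ-≡ _ _ _ q+t≡last)

    edge⇒consecutive : ∀ {p q} → Position p → Position q → E (cycle p) (cycle q) → Consecutive p q
    edge⇒consecutive (onX s≤h) (onX t≤h) e =
      Sum.map₂ inj₁ (X-chordless s≤h t≤h (subst₂ E (cycle-X s≤h) (cycle-X t≤h) e))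
    edge⇒consecutive {p} {q} (onY {t = s} s≤h p+s≡last) (onY {t = t} t≤h q+t≡last) e
      with Y-chordless s≤h t≤h (subst₂ E (cycle-Y s≤h p+s≡last) (cycle-Y t≤h q+t≡last) e)
    ... | inj₁ refl = inj₂ (inj₁ (+-cancelʳ-≡ _ _ _ (trans p+s≡last (trans (sym q+t≡last) (+-suc q s)))))
    ... | inj₂ refl = inj₁ (+-cancelʳ-≡ _ _ _ (trans q+t≡last (trans (sym p+s≡last) (+-suc p t))))
    edge⇒consecutive (onX s≤h) (onY t≤h q+t≡last) e =
      rung⇒consecutive s≤h t≤h q+t≡last (subst₂ E (cycle-X s≤h) (cycle-Y t≤h q+t≡last) e)
    edge⇒consecutive (onY s≤h p+s≡last) (onX t≤h) e =
      consecutive-sym (rung⇒consecutive t≤h s≤h p+s≡last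
        (E-sym (subst₂ E (cycle-Y s≤h p+s≡last) (cycle-X t≤h) e)))

    cycle-step : ∀ {p} → Position p → suc p < length → E (cycle p) (cycle (suc p))
    cycle-step {p} (onX s≤h) _ with m≤n⇒m<n∨m≡n s≤h
    ... | inj₁ s<h  = subst₂ E (sym (cycle-X s≤h)) (sym (cycle-X s<h)) (X-step p s<h)
    ... | inj₂ refl = subst₂ E (sym (cycle-X s≤h)) (sym (cycle-Y ≤-refl refl)) top-rung
    cycle-step {p} (onY {t = zero} _ p+0≡last) 1+p<length =
      ⊥-elim (<-irrefl (sym length≡1+last)
        (subst (λ r → suc r < length) (trans (sym (+-identityʳ p)) p+0≡last) 1+p<length))
    cycle-step {p} (onY {t = suc t} 1+t≤h p+1+t≡last) _ =
      subst₂ E (sym (cycle-Y 1+t≤h p+1+t≡last))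
               (sym (cycle-Y (<⇒≤ 1+t≤h) (trans (sym (+-suc p t)) p+1+t≡last)))
               (E-sym (Y-step t 1+t≤h))

    cycle-wrap : E (cycle 0) (cycle last)
    cycle-wrap = subst₂ E (sym (cycle-X z≤n)) (sym (cycle-Y z≤n (+-identityʳ last))) bottom-rung

    consecutive⇒edge : ∀ {p q} → p < length → q < length → Consecutive p q → E (cycle p) (cycle q)
    consecutive⇒edge {p} _ q<length (inj₁ refl) = cycle-step (position p (<-trans (n<1+n p) q<length)) q<length
    consecutive⇒edge {q = q} p<length _ (inj₂ (inj₁ refl)) =
      E-sym (cycle-step (position q (<-trans (n<1+n q) p<length)) p<length)
    consecutive⇒edge _ _ (inj₂ (inj₂ (inj₁ (refl , 1+q≡length)))) with suc-injective (trans 1+q≡length length≡1+last)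
    ... | refl = cycle-wrap
    consecutive⇒edge _ _ (inj₂ (inj₂ (inj₂ (refl , 1+p≡length)))) with suc-injective (trans 1+p≡length length≡1+last)
    ... | refl = E-sym cycle-wrap

    cycle-injective : ∀ {p q} → Position p → Position q → cycle p ≡ cycle q → p ≡ q
    cycle-injective (onX s≤h) (onX t≤h) eq =
      X-injective s≤h t≤h (trans (sym (cycle-X s≤h)) (trans eq (cycle-X t≤h)))
    cycle-injective (onY s≤h p+s≡last) (onY t≤h q+t≡last) eq
      with Y-injective s≤h t≤h (trans (sym (cycle-Y s≤h p+s≡last)) (trans eq (cycle-Y t≤h q+t≡last)))
    ... | refl = +-cancelʳ-≡ _ _ _ (trans p+s≡last (sym q+t≡last))
    cycle-injective (onX s≤h) (onY t≤h q+t≡last) eq =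
      ⊥-elim (XY-disjoint s≤h t≤h (trans (sym (cycle-X s≤h)) (trans eq (cycle-Y t≤h q+t≡last))))
    cycle-injective (onY s≤h p+s≡last) (onX t≤h) eq =
      ⊥-elim (XY-disjoint t≤h s≤h (trans (sym (cycle-X t≤h)) (trans (sym eq) (cycle-Y s≤h p+s≡last))))

    vertex : Fin length → Fin n
    vertex i = cycle (toℕ i)

    positionOf : (i : Fin length) → Position (toℕ i)
    positionOf i = position (toℕ i) (toℕ<n i)

    isInducedCycle : InducedCycle G length vertex
    isInducedCycle =
      (λ {i} {j} eq → toℕ-injective (cycle-injective (positionOf i) (positionOf j) eq)) ,
      λ i j → mk⇔ (edge⇒consecutive (positionOf i) (positionOf j)) (consecutive⇒edge (toℕ<n i) (toℕ<n j))

  parallelInducedPaths⇒evenHole : ∀ {h X Y} → 1 ≤ h → ParallelInducedPaths h X Y → HasEvenHole G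
  parallelInducedPaths⇒evenHole {h} 1≤h P =
    length , subst (4 ≤_) (sym length≡1+last) (s≤s (s≤s (+-mono-≤ 1≤h 1≤h))) , (suc h , refl) ,
    vertex , isInducedCycle
    where open ParallelPathsCycle P

  twoVertexPath-chordless : ∀ {Z : ℕ → Fin n} {s t} → s ≤ 1 → t ≤ 1 → E (Z s) (Z t) → t ≡ suc s ⊎ s ≡ suc t
  twoVertexPath-chordless {s = zero}      {zero}      _ _ e = ⊥-elim (E-irr e)
  twoVertexPath-chordless {s = zero}      {suc zero}  _ _ _ = inj₁ refl
  twoVertexPath-chordless {s = suc zero}  {zero}      _ _ _ = inj₂ refl
  twoVertexPath-chordless {s = suc zero}  {suc zero}  _ _ e = ⊥-elim (E-irr e)
  twoVertexPath-chordless {s = suc (suc _)} (s≤s ()) _ _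
  twoVertexPath-chordless {t = suc (suc _)} _ (s≤s ()) _

  twoVertexPath-injective : ∀ {Z : ℕ → Fin n} {s t} → E (Z 0) (Z 1) → s ≤ 1 → t ≤ 1 → Z s ≡ Z t → s ≡ t
  twoVertexPath-injective {s = zero}       {zero}      _ _ _ _  = refl
  twoVertexPath-injective {s = zero}       {suc zero}  e _ _ eq = ⊥-elim (edge⇒≢ e eq)
  twoVertexPath-injective {s = suc zero}   {zero}      e _ _ eq = ⊥-elim (edge⇒≢ e (sym eq))
  twoVertexPath-injective {s = suc zero}   {suc zero}  _ _ _ _  = refl
  twoVertexPath-injective {s = suc (suc _)} _ (s≤s ()) _ _
  twoVertexPath-injective {t = suc (suc _)} _ _ (s≤s ()) _

  square⇒evenHole : ∀ {a b c d} → E a b → E b c → E c d → E d a → ¬ E a c → ¬ E b d → a ≢ c → b ≢ d →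
                    HasEvenHole G
  square⇒evenHole {a} {b} {c} {d} ab bc cd da ¬ac ¬bd a≢c b≢d = parallelInducedPaths⇒evenHole ≤-refl record
    { X-step      = λ { zero _ → ab ; (suc _) (s≤s ()) }
    ; Y-step      = λ { zero _ → E-sym cd ; (suc _) (s≤s ()) }
    ; X-chordless = twoVertexPath-chordless
    ; Y-chordless = twoVertexPath-chordless
    ; X-injective = twoVertexPath-injective ab
    ; Y-injective = twoVertexPath-injective (E-sym cd)
    ; XY-disjoint = disjoint
    ; XY-edges    = edges
    ; bottom-rung = E-sym da
    ; top-rung    = bc
    }
    where
    X Y : ℕ → Fin n
    X = a ◂ const b
    Y = d ◂ const c

    disjoint : ∀ {s t} → s ≤ 1 → t ≤ 1 → X s ≢ Y t
    disjoint {zero}      {zero}     _ _ = edge⇒≢ (E-sym da)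
    disjoint {zero}      {suc zero} _ _ = a≢c
    disjoint {suc zero}  {zero}     _ _ = b≢d
    disjoint {suc zero}  {suc zero} _ _ = edge⇒≢ bc
    disjoint {suc (suc _)} (s≤s ()) _
    disjoint {t = suc (suc _)} _ (s≤s ())

    edges : ∀ {s t} → s ≤ 1 → t ≤ 1 → E (X s) (Y t) → (s ≡ 0 × t ≡ 0) ⊎ (s ≡ 1 × t ≡ 1)
    edges {zero}      {zero}     _ _ _ = inj₁ (refl , refl)
    edges {zero}      {suc zero} _ _ e = ⊥-elim (¬ac e)
    edges {suc zero}  {zero}     _ _ e = ⊥-elim (¬bd e)
    edges {suc zero}  {suc zero} _ _ _ = inj₂ (refl , refl)
    edges {suc (suc _)} (s≤s ()) _ _
    edges {t = suc (suc _)} _ (s≤s ()) _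

module LevelStructure {n : ℕ} (G : Graph n) (u₀ u₁ : Fin n) where
  open Graph G
  open Levels G u₀ u₁
  open GraphBasics G
  open InducedCycles G

  L-cast : ∀ {a b v} → a ≡ b → L a v → L b v
  L-cast refl l = l

  parent : ∀ {j v} → L (suc j) v → ∃ λ p → L j p × E p v
  parent (g , w , shortest) with walk-unsnoc w
  ... | p , w′ , e = p , (walk-target w′ , w′ , λ m m<j w″ → shortest (suc m) (s≤s m<j) (walk-snoc w″ e g)) , e

  L-edge : ∀ {a b x y} → L a x → L b y → E x y → b ≤ suc a
  L-edge (_ , wx , _) (gy , _ , shortest) e = ≮⇒≥ λ lt → shortest _ lt (walk-snoc wx e gy)

  L-unique : ∀ {a b v} → L a v → L b v → a ≡ b
  L-unique (_ , wa , shortestᵃ) (_ , wb , shortestᵇ) =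
    ≤-antisym (≮⇒≥ λ lt → shortestᵃ _ lt wb) (≮⇒≥ λ lt → shortestᵇ _ lt wa)

  L-zero : ∀ {v} → L 0 v → v ≡ u₀
  L-zero (_ , here _ , _) = refl

  L-one : ∀ {v} → L 1 v → v ≡ u₁
  L-one {v} lv@((_ , w) , _) with parent lv
  ... | _ , lp , e with L-zero lp
  ... | refl with v ≟ᶠ u₁
  ... | yes v≡u₁ = v≡u₁
  ... | no  v≢u₁ = ⊥-elim (walk-target w (e , v≢u₁))

  L-offset-edge : ∀ m {s t x y} → L (m + s) x → L (m + t) y → E x y → t ≤ suc s
  L-offset-edge m {s} {t} lx ly e = +-cancelˡ-≤ m t (suc s) (subst (m + t ≤_) (sym (+-suc m s)) (L-edge lx ly e))

  L-offset-injective : ∀ m {s t x y} → L (m + s) x → L (m + t) y → x ≡ y → s ≡ t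
  L-offset-injective m lx ly refl = +-cancelˡ-≡ m _ _ (L-unique lx ly)

  climbing-chordless : ∀ m {Z : ℕ → Fin n} {s t} → L (m + s) (Z s) → L (m + t) (Z t) → E (Z s) (Z t) →
                       t ≡ suc s ⊎ s ≡ suc t
  climbing-chordless m ls lt e =
    differByOne (L-offset-edge m ls lt e) (L-offset-edge m lt ls (E-sym e)) λ { refl → E-irr e }

  levelComp⊆level : ∀ {i x} → LevelComp i x ⊆ L i
  levelComp⊆level (_ , w) = walk-target w

  levelOne-clique : ∀ {x} → IsClique G (LevelComp 1 x)
  levelOne-clique _ _ cv cw v≢w =
    ⊥-elim (v≢w (trans (L-one (levelComp⊆level cv)) (sym (L-one (levelComp⊆level cw)))))

  NotB₀? : Decidable NotB₀
  NotB₀? v = ¬? (E-dec u₀ v ×-dec ¬? (v ≟ᶠ u₁))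

  G₀⊆NotB₀ : G₀ ⊆ NotB₀
  G₀⊆NotB₀ (_ , w) = walk-target w

  walk-inG₀ : ∀ {v k} → Walk G NotB₀ u₀ v k → Walk G G₀ u₀ v k
  walk-inG₀ = walk-withinComponent (here λ (u₀u₀ , _) → E-irr u₀u₀)

  L? : ∀ j → Decidable (L j)
  L? j v = map′ fromWalks toWalks (walk? NotB₀? j u₀ v ×-dec allUpTo? (λ m → ¬? (walk? NotB₀? m u₀ v)) j)
    where
    fromWalks : Walk G NotB₀ u₀ v j × (∀ {m} → m < j → ¬ Walk G NotB₀ u₀ v m) → L j v
    fromWalks (w , noShorter) = (j , w) , walk-inG₀ w , λ _ m<j w′ → noShorter m<j (walk-map G₀⊆NotB₀ w′)

    toWalks : L j v → Walk G NotB₀ u₀ v j × (∀ {m} → m < j → ¬ Walk G NotB₀ u₀ v m)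
    toWalks (_ , w , shortest) = walk-map G₀⊆NotB₀ w , λ m<j w′ → shortest _ m<j (walk-inG₀ w′)

  -- The bottom pair X 0, Y 0 is left unconstrained: an edge there closes an even hole.
  record Ladder (m h : ℕ) (X Y : ℕ → Fin n) : Set where
    field
      X-level        : ∀ t → t ≤ h → L (m + t) (X t)
      Y-level        : ∀ t → t ≤ h → L (m + t) (Y t)
      X-step         : ∀ t → t < h → E (X t) (X (suc t))
      Y-step         : ∀ t → t < h → E (Y t) (Y (suc t))
      top-rung       : E (X h) (Y h)
      no-rung        : ∀ t → 0 < t → t < h → X t ≢ Y t × ¬ E (X t) (Y t)
      no-XY-diagonal : ∀ t → t < h → ¬ E (X t) (Y (suc t))
      no-YX-diagonal : ∀ t → t < h → ¬ E (Y t) (X (suc t))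

    X₀-level : L m (X 0)
    X₀-level = L-cast (+-identityʳ m) (X-level 0 z≤n)

    Y₀-level : L m (Y 0)
    Y₀-level = L-cast (+-identityʳ m) (Y-level 0 z≤n)

  closedLadder⇒parallelInducedPaths : ∀ {m h X Y} → Ladder m h X Y → E (X 0) (Y 0) →
                                      ParallelInducedPaths h X Y
  closedLadder⇒parallelInducedPaths {m} {h} {X} {Y} ℓ bottom = record
    { X-step      = X-step
    ; Y-step      = Y-step
    ; X-chordless = λ s≤h t≤h → climbing-chordless m (X-level _ s≤h) (X-level _ t≤h)
    ; Y-chordless = λ s≤h t≤h → climbing-chordless m (Y-level _ s≤h) (Y-level _ t≤h)
    ; X-injective = λ s≤h t≤h → L-offset-injective m (X-level _ s≤h) (X-level _ t≤h)
    ; Y-injective = λ s≤h t≤h → L-offset-injective m (Y-level _ s≤h) (Y-level _ t≤h)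
    ; XY-disjoint = disjoint
    ; XY-edges    = rungs
    ; bottom-rung = bottom
    ; top-rung    = top-rung
    }
    where
    open Ladder ℓ

    rung-atEnd : ∀ {t} → t ≤ h → X t ≡ Y t ⊎ E (X t) (Y t) → t ≡ 0 ⊎ t ≡ h
    rung-atEnd {zero}  _   _ = inj₁ refl
    rung-atEnd {suc t} t≤h r with suc t ≟ h
    ... | yes t≡h = inj₂ t≡h
    ... | no  t≢h = ⊥-elim ([ proj₁ apart , proj₂ apart ] r)
      where
      apart : X (suc t) ≢ Y (suc t) × ¬ E (X (suc t)) (Y (suc t))
      apart = no-rung (suc t) z<s (≤∧≢⇒< t≤h t≢h)

    disjoint : ∀ {s t} → s ≤ h → t ≤ h → X s ≢ Y t
    disjoint s≤h t≤h eq with L-offset-injective m (X-level _ s≤h) (Y-level _ t≤h) eq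
    ... | refl with rung-atEnd s≤h (inj₁ eq)
    ...   | inj₁ refl = edge⇒≢ bottom eq
    ...   | inj₂ refl = edge⇒≢ top-rung eq

    rungs : ∀ {s t} → s ≤ h → t ≤ h → E (X s) (Y t) → (s ≡ 0 × t ≡ 0) ⊎ (s ≡ h × t ≡ h)
    rungs {s} {t} s≤h t≤h e with <-cmp s t
    ... | tri< s<t _ _ with ≤-antisym (L-offset-edge m (X-level s s≤h) (Y-level t t≤h) e) s<t
    ...   | refl = ⊥-elim (no-XY-diagonal s t≤h e)
    rungs {s} {t} s≤h t≤h e | tri> _ _ t<s
      with ≤-antisym (L-offset-edge m (Y-level t t≤h) (X-level s s≤h) (E-sym e)) t<s
    ...   | refl = ⊥-elim (no-YX-diagonal t s≤h (E-sym e))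
    rungs s≤h t≤h e | tri≈ _ refl _ = Sum.map (λ eq → eq , eq) (λ eq → eq , eq) (rung-atEnd s≤h (inj₂ e))

  module _ (noClaw : ¬ HasInducedClaw G) where

    no-common-parent : ∀ {j x y p} → L (suc (suc j)) x → L (suc (suc j)) y → x ≢ y → ¬ E x y →
                       L (suc j) p → E p x → E p y → ⊥
    no-common-parent {j} {x} {y} {p} lx ly x≢y ¬xy lp px py with parent lp
    ... | q , lq , qp =
      noClaw (p , q , x , y , q≢ lx , q≢ ly , x≢y , E-sym qp , px , py , ¬q~ lx , ¬q~ ly , ¬xy)
      where
      q≢ : ∀ {z} → L (suc (suc j)) z → q ≢ z
      q≢ lz refl with L-unique lq lz
      ... | ()

      ¬q~ : ∀ {z} → L (suc (suc j)) z → ¬ E q z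
      ¬q~ lz qz = n≮n _ (L-edge lq lz qz)

    module _ {m h X Y p q} (ℓ : Ladder (suc (suc m)) h X Y) (X₀≢Y₀ : X 0 ≢ Y 0) (¬X₀Y₀ : ¬ E (X 0) (Y 0))
             (lp : L (suc m) p) (pX₀ : E p (X 0)) (lq : L (suc m) q) (qY₀ : E q (Y 0)) where
      private
        module ℓ = Ladder ℓ

        X₀-Y₀-noCommonParent : ∀ {r} → L (suc m) r → E r (X 0) → E r (Y 0) → ⊥
        X₀-Y₀-noCommonParent = no-common-parent ℓ.X₀-level ℓ.Y₀-level X₀≢Y₀ ¬X₀Y₀

      ladder-extend : Ladder (suc m) (suc h) (p ◂ X) (q ◂ Y)
      Ladder.X-level ladder-extend zero    _   = L-cast (sym (+-identityʳ _)) lp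
      Ladder.X-level ladder-extend (suc t) t≤h = L-cast (sym (+-suc (suc m) t)) (ℓ.X-level t (s≤s⁻¹ t≤h))
      Ladder.Y-level ladder-extend zero    _   = L-cast (sym (+-identityʳ _)) lq
      Ladder.Y-level ladder-extend (suc t) t≤h = L-cast (sym (+-suc (suc m) t)) (ℓ.Y-level t (s≤s⁻¹ t≤h))
      Ladder.X-step ladder-extend zero    _   = pX₀
      Ladder.X-step ladder-extend (suc t) t<h = ℓ.X-step t (s≤s⁻¹ t<h)
      Ladder.Y-step ladder-extend zero    _   = qY₀
      Ladder.Y-step ladder-extend (suc t) t<h = ℓ.Y-step t (s≤s⁻¹ t<h)
      Ladder.top-rung ladder-extend = ℓ.top-rung
      Ladder.no-rung ladder-extend (suc zero)    _ _   = X₀≢Y₀ , ¬X₀Y₀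
      Ladder.no-rung ladder-extend (suc (suc t)) _ t<h = ℓ.no-rung (suc t) z<s (s≤s⁻¹ t<h)
      Ladder.no-XY-diagonal ladder-extend zero    _ pY₀ = X₀-Y₀-noCommonParent lp pX₀ pY₀
      Ladder.no-XY-diagonal ladder-extend (suc t) t<h = ℓ.no-XY-diagonal t (s≤s⁻¹ t<h)
      Ladder.no-YX-diagonal ladder-extend zero    _ qX₀ = X₀-Y₀-noCommonParent lq qX₀ qY₀
      Ladder.no-YX-diagonal ladder-extend (suc t) t<h = ℓ.no-YX-diagonal t (s≤s⁻¹ t<h)

    module _ (noHole : ¬ HasEvenHole G) where

      -- Extending by parents either closes the ladder into an even hole or reaches L₁ = {u₁}.
      openLadder-impossible : ∀ {m h X Y} → Ladder (suc m) h X Y → 1 ≤ h → X 0 ≢ Y 0 → ⊥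
      openLadder-impossible {X = X} {Y} ℓ 1≤h X₀≢Y₀ with E-dec (X 0) (Y 0)
      ... | yes bottom = noHole (parallelInducedPaths⇒evenHole 1≤h (closedLadder⇒parallelInducedPaths ℓ bottom))
      openLadder-impossible {zero} ℓ _ X₀≢Y₀ | no _ =
        X₀≢Y₀ (trans (L-one (Ladder.X₀-level ℓ)) (sym (L-one (Ladder.Y₀-level ℓ))))
      openLadder-impossible {suc m} ℓ _ X₀≢Y₀ | no ¬X₀Y₀
        with parent (Ladder.X₀-level ℓ) | parent (Ladder.Y₀-level ℓ)
      ... | p , lp , pX₀ | q , lq , qY₀ =
        openLadder-impossible (ladder-extend ℓ X₀≢Y₀ ¬X₀Y₀ lp pX₀ lq qY₀) (s≤s z≤n) p≢q
        where
        p≢q : p ≢ q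
        p≢q refl = no-common-parent (Ladder.X₀-level ℓ) (Ladder.Y₀-level ℓ) X₀≢Y₀ ¬X₀Y₀ lp pX₀ qY₀

      parent-crossEdge : ∀ {j x y x′ y′} → L (suc (suc j)) x → L (suc (suc j)) y → E x y →
                         L (suc j) x′ → E x′ x → L (suc j) y′ → E y′ y → E x′ y ⊎ E y′ x
      parent-crossEdge {j} {x} {y} {x′} {y′} lx ly xy lx′ x′x ly′ y′y with E-dec x′ y | E-dec y′ x
      ... | yes x′y | _       = inj₁ x′y
      ... | no _    | yes y′x = inj₂ y′x
      ... | no ¬x′y | no ¬y′x = ⊥-elim (openLadder-impossible ladder (s≤s z≤n) x′≢y′)
        where
        x′≢y′ : x′ ≢ y′
        x′≢y′ refl = ¬x′y y′y

        ladder : Ladder (suc j) 1 (x′ ◂ const x) (y′ ◂ const y)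
        ladder = record
          { X-level        = λ { zero _ → L-cast (sym (+-identityʳ _)) lx′
                               ; (suc zero) _ → L-cast (sym (+-comm (suc j) 1)) lx
                               ; (suc (suc _)) (s≤s ()) }
          ; Y-level        = λ { zero _ → L-cast (sym (+-identityʳ _)) ly′
                               ; (suc zero) _ → L-cast (sym (+-comm (suc j) 1)) ly
                               ; (suc (suc _)) (s≤s ()) }
          ; X-step         = λ { zero _ → x′x ; (suc _) (s≤s ()) }
          ; Y-step         = λ { zero _ → y′y ; (suc _) (s≤s ()) }
          ; top-rung       = xy
          ; no-rung        = λ { (suc _) _ (s≤s ()) }
          ; no-XY-diagonal = λ { zero _ → ¬x′y ; (suc _) (s≤s ()) }
          ; no-YX-diagonal = λ { zero _ → ¬y′x ; (suc _) (s≤s ()) }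
          }

      module LevelComponent (j : ℕ) (x : Fin n) where
        Li C : Pred (Fin n) 0ℓ
        Li = L (suc (suc j))
        C  = LevelComp (suc (suc j)) x

        C⊆Li : C ⊆ Li
        C⊆Li = levelComp⊆level

        -- Each application of parent-crossEdge moves a parent one step along the path;
        -- within four steps one parent sees both ends of a non-edge of the P₄.
        noInducedP4-sharedParent : ∀ {a b c d b′} → Li a → Li b → Li c → Li d → E a b → E b c → E c d →
          ¬ E a c → ¬ E b d → a ≢ c → b ≢ d → L (suc j) b′ → E b′ b → E b′ c → ⊥
        noInducedP4-sharedParent la lb lc ld ab bc cd ¬ac ¬bd a≢c b≢d lb′ b′b b′c
          with parent la | parent lc | parent ld
        ... | a′ , la′ , a′a | c′ , lc′ , c′c | d′ , ld′ , d′d with parent-crossEdge la lb ab la′ a′a lb′ b′b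
        ...   | inj₂ b′a = no-common-parent la lc a≢c ¬ac lb′ b′a b′c
        ...   | inj₁ a′b with parent-crossEdge lb lc bc la′ a′b lc′ c′c
        ...     | inj₁ a′c = no-common-parent la lc a≢c ¬ac la′ a′a a′c
        ...     | inj₂ c′b with parent-crossEdge lc ld cd lc′ c′c ld′ d′d
        ...       | inj₁ c′d = no-common-parent lb ld b≢d ¬bd lc′ c′b c′d
        ...       | inj₂ d′c with parent-crossEdge lb lc bc la′ a′b ld′ d′c
        ...         | inj₁ a′c = no-common-parent la lc a≢c ¬ac la′ a′a a′c
        ...         | inj₂ d′b = no-common-parent lb ld b≢d ¬bd ld′ d′b d′d

        noInducedP4 : ∀ {a b c d} → Li a → Li b → Li c → Li d → E a b → E b c → E c d →
                      ¬ E a c → ¬ E b d → a ≢ c → b ≢ d → ⊥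
        noInducedP4 la lb lc ld ab bc cd ¬ac ¬bd a≢c b≢d with parent lb | parent lc
        ... | b′ , lb′ , b′b | c′ , lc′ , c′c with parent-crossEdge lb lc bc lb′ b′b lc′ c′c
        ...   | inj₁ b′c = noInducedP4-sharedParent la lb lc ld ab bc cd ¬ac ¬bd a≢c b≢d lb′ b′b b′c
        ...   | inj₂ c′b = noInducedP4-sharedParent ld lc lb la (E-sym cd) (E-sym bc) (E-sym ab)
                             (λ e → ¬bd (E-sym e)) (λ e → ¬ac (E-sym e))
                             (λ eq → b≢d (sym eq)) (λ eq → a≢c (sym eq)) lc′ c′c c′b

        walk⇒dist≤2 : ∀ {a b k} → Walk G Li a b k → Dist≤2 Li a b
        walk⇒dist≤2 (here _) = inj₁ refl
        walk⇒dist≤2 {a} {b} (step {y = a₁} _ aa₁ w) with walk⇒dist≤2 w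
        ... | inj₁ refl = inj₂ (inj₁ aa₁)
        ... | inj₂ (inj₁ a₁b) with a ≟ᶠ b
        ...   | yes a≡b = inj₁ a≡b
        ...   | no  _   with E-dec a b
        ...     | yes ab = inj₂ (inj₁ ab)
        ...     | no  _  = inj₂ (inj₂ (a₁ , walk-source w , aa₁ , a₁b))
        walk⇒dist≤2 {a} {b} (step {y = a₁} la aa₁ w) | inj₂ (inj₂ (m , lm , a₁m , mb)) with a ≟ᶠ b
        ...   | yes a≡b = inj₁ a≡b
        ...   | no  _   with E-dec a b
        ...     | yes ab = inj₂ (inj₁ ab)
        ...     | no ¬ab with E-dec a m
        ...       | yes am = inj₂ (inj₂ (m , lm , am , mb))
        ...       | no ¬am with a ≟ᶠ m
        ...         | yes refl = ⊥-elim (¬ab mb)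
        ...         | no a≢m with E-dec a₁ b
        ...           | yes a₁b = inj₂ (inj₂ (a₁ , walk-source w , aa₁ , a₁b))
        ...           | no ¬a₁b = ⊥-elim (noInducedP4 la (walk-source w) lm (walk-target w) aa₁ a₁m mb
                                                     ¬am ¬a₁b a≢m λ a₁≡b → ¬ab (subst (E a) a₁≡b aa₁))

        C? : Decidable C
        C? v = map′ (λ { (k , _ , w) → k , w })
                    (λ { (_ , w) → dist≤2⇒walk (walk-source w) (walk-target w) (walk⇒dist≤2 w) })
                    (anyUpTo? (λ k → walk? (L? (suc (suc j))) k x v) 3)

        commonNeighbour : ∀ {a b} → C a → C b → a ≢ b → ¬ E a b → ∃ λ m → C m × E a m × E m b
        commonNeighbour (k , xa) (_ , xb) a≢b ¬ab with walk⇒dist≤2 (walk-++ (walk-reverse xa) xb)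
        ... | inj₁ a≡b                       = ⊥-elim (a≢b a≡b)
        ... | inj₂ (inj₁ ab)                 = ⊥-elim (¬ab ab)
        ... | inj₂ (inj₂ (m , lm , am , mb)) = m , (suc k , walk-snoc xa am lm) , am , mb

        noStableTriple : ∀ {p q r} → C p → C q → C r → p ≢ q → p ≢ r → q ≢ r →
                         ¬ E p q → ¬ E p r → ¬ E q r → ⊥
        noStableTriple {p} {q} {r} cp cq cr p≢q p≢r q≢r ¬pq ¬pr ¬qr
          with commonNeighbour cp cq p≢q ¬pq | commonNeighbour cp cr p≢r ¬pr
        ... | w , cw , pw , wq | u , cu , pu , ur with E-dec w r | E-dec u q
        ...   | yes wr | _      = noClaw (w , p , q , r , p≢q , p≢r , q≢r , E-sym pw , wq , wr , ¬pq , ¬pr , ¬qr)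
        ...   | no _   | yes uq = noClaw (u , p , q , r , p≢q , p≢r , q≢r , E-sym pu , uq , ur , ¬pq , ¬pr , ¬qr)
        ...   | no ¬wr | no ¬uq with E-dec u w
        ...     | yes uw = noInducedP4 (C⊆Li cq) (C⊆Li cw) (C⊆Li cu) (C⊆Li cr) (E-sym wq) (E-sym uw) ur
                             (λ e → ¬uq (E-sym e)) ¬wr (λ q≡u → ¬pq (subst (E p) (sym q≡u) pu))
                             (λ w≡r → ¬pr (subst (E p) w≡r pw))
        ...     | no ¬uw = noInducedP4 (C⊆Li cr) (C⊆Li cu) (C⊆Li cp) (C⊆Li cw) (E-sym ur) (E-sym pu) pw
                             (λ e → ¬pr (E-sym e)) ¬uw (λ r≡p → p≢r (sym r≡p))
                             (λ u≡w → ¬wr (subst (λ z → E z r) u≡w ur))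

        module Split {a b} (ca : C a) (cb : C b) (a≢b : a ≢ b) (¬ab : ¬ E a b) where
          A B K : Pred (Fin n) 0ℓ
          A v = C v × v ≢ b × ¬ E v b
          B v = C v × v ≢ a × ¬ E v a
          K v = C v × E v a × E v b

          A∩B-empty : ∀ v → A v → B v → ⊥
          A∩B-empty v (cv , v≢b , ¬vb) (_ , v≢a , ¬va) = noStableTriple cv ca cb v≢a v≢b a≢b ¬va ¬vb ¬ab

          A-K-adjacent : ∀ {v w} → A v → K w → v ≢ w → E v w
          A-K-adjacent {v} {w} (cv , v≢b , ¬vb) (cw , wa , wb) v≢w with E-dec v w | v ≟ᶠ a
          ... | yes vw | _        = vw
          ... | no _   | yes refl = E-sym wa
          ... | no ¬vw | no v≢a with E-dec v a
          ...   | no ¬va = ⊥-elim (noStableTriple cv ca cb v≢a v≢b a≢b ¬va ¬vb ¬ab)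
          ...   | yes va = ⊥-elim (noInducedP4 (C⊆Li cv) (C⊆Li ca) (C⊆Li cw) (C⊆Li cb)
                                                va (E-sym wa) wb ¬vw ¬ab v≢w a≢b)

          A∪K-clique : IsClique G (λ v → A v ⊎ K v)
          A∪K-clique v w (inj₁ (cv , v≢b , ¬vb)) (inj₁ (cw , w≢b , ¬wb)) v≢w with E-dec v w
          ... | yes vw = vw
          ... | no ¬vw = ⊥-elim (noStableTriple cv cw cb v≢w v≢b w≢b ¬vw ¬vb ¬wb)
          A∪K-clique v w (inj₁ av) (inj₂ kw) v≢w = A-K-adjacent av kw v≢w
          A∪K-clique v w (inj₂ kv) (inj₁ aw) v≢w = E-sym (A-K-adjacent aw kv λ w≡v → v≢w (sym w≡v))
          A∪K-clique v w (inj₂ (_ , va , vb)) (inj₂ (_ , wa , wb)) v≢w with E-dec v w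
          ... | yes vw = vw
          ... | no ¬vw = ⊥-elim (noHole (square⇒evenHole (E-sym va) vb (E-sym wb) wa ¬ab ¬vw a≢b v≢w))

          A-B-nonadjacent : ∀ v w → A v → B w → ¬ E v w
          A-B-nonadjacent v w (cv , v≢b , ¬vb) (cw , w≢a , ¬wa) vw with v ≟ᶠ a | w ≟ᶠ b
          ... | yes refl | _        = ¬wa (E-sym vw)
          ... | no _     | yes refl = ¬vb vw
          ... | no v≢a   | no w≢b with E-dec v a | E-dec w b
          ...   | no ¬va | _      = noStableTriple cv ca cb v≢a v≢b a≢b ¬va ¬vb ¬ab
          ...   | yes _  | no ¬wb = noStableTriple cw ca cb w≢a w≢b a≢b ¬wa ¬wb ¬ab
          ...   | yes va | yes wb = noInducedP4 (C⊆Li ca) (C⊆Li cv) (C⊆Li cw) (C⊆Li cb) (E-sym va) vw wb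
                                      (λ aw → ¬wa (E-sym aw)) ¬vb (λ a≡w → w≢a (sym a≡w)) v≢b

          K-nonempty : ∃ K
          K-nonempty with commonNeighbour ca cb a≢b ¬ab
          ... | m , cm , am , mb = m , cm , E-sym am , mb

          partition : ∀ v → C v → A v ⊎ B v ⊎ K v
          partition v cv with v ≟ᶠ b
          ... | yes refl = inj₂ (inj₁ (cv , (λ b≡a → a≢b (sym b≡a)) , λ ba → ¬ab (E-sym ba)))
          ... | no v≢b with E-dec v b
          ...   | no ¬vb = inj₁ (cv , v≢b , ¬vb)
          ...   | yes vb with E-dec v a
          ...     | yes va = inj₂ (inj₂ (cv , va , vb))
          ...     | no ¬va with v ≟ᶠ a
          ...       | yes refl = ⊥-elim (¬ab vb)
          ...       | no v≢a   = inj₂ (inj₁ (cv , v≢a , ¬va))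

        twoClique : ∀ {a b} → C a → C b → a ≢ b → ¬ E a b → Is2Clique G C
        twoClique {a} {b} ca cb a≢b ¬ab =
          A , B , K , partition , (λ _ → proj₁) , (λ _ → proj₁) , (λ _ → proj₁) , A∩B-empty ,
          (λ _ (_ , _ , ¬vb) (_ , _ , vb) → ¬vb vb) , (λ _ (_ , _ , ¬va) (_ , va , _) → ¬va va) ,
          (a , ca , a≢b , ¬ab) , (b , cb , b≢a , ¬ba) , K-nonempty , A∪K-clique , B∪K-clique , A-B-nonadjacent
          where
          open Split ca cb a≢b ¬ab

          b≢a : b ≢ a
          b≢a b≡a = a≢b (sym b≡a)

          ¬ba : ¬ E b a
          ¬ba ba = ¬ab (E-sym ba)

          module Swapped = Split cb ca b≢a ¬ba

          swap : ∀ {v} → B v ⊎ K v → Swapped.A v ⊎ Swapped.K v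
          swap (inj₁ bv)             = inj₁ bv
          swap (inj₂ (cv , va , vb)) = inj₂ (cv , vb , va)

          B∪K-clique : IsClique G (λ v → B v ⊎ K v)
          B∪K-clique v w bkv bkw = Swapped.A∪K-clique v w (swap bkv) (swap bkw)

        clique⊎twoClique : IsClique G C ⊎ Is2Clique G C
        clique⊎twoClique = Sum.map₂ (λ { (_ , _ , ca , cb , a≢b , ¬ab) → twoClique ca cb a≢b ¬ab })
                                    (clique⊎nonadjacentPair C?)

lemma2p6 : ∀ {n} (G : Graph n) → ¬ HasInducedClaw G → ¬ HasEvenHole G →
    (u₀ u₁ : Fin n) → Graph.E G u₀ u₁ →
    (i : ℕ) → 1 ≤ i → (x : Fin n) → Levels.L G u₀ u₁ i x →
    IsClique G (Levels.LevelComp G u₀ u₁ i x) ⊎ Is2Clique G (Levels.LevelComp G u₀ u₁ i x)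
lemma2p6 G _ _ u₀ u₁ _ (suc zero) _ _ _ = inj₁ (LevelStructure.levelOne-clique G u₀ u₁)
lemma2p6 G noClaw noHole u₀ u₁ _ (suc (suc j)) _ x _ =
  LevelStructure.LevelComponent.clique⊎twoClique G u₀ u₁ noClaw noHole j x
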